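{- Let $G=(V,A)$ be a flow graph with start vertex $s$ and dominator tree $D$, and let $T$ be a rooted tree whose vertex set is a subset of $V$. If $T$ has the parent property and has a preorder that is low-high on $G$, then $T$ has the sibling property, and hence $T=D$.
   Context: A flow graph is a finite directed graph $G=(V,A)$ with a designated start vertex $s$ such that every vertex is reachable from $s$; throughout, there are no arcs entering $s$ and $|V|>1$. A vertex $v$ dominates $w$ if every path from $s$ to $w$ contains $v$. The dominator tree $D$ is the tree rooted at $s$ on $V$ in which $v$ is an ancestor of $w$ iff $v$ dominates $w$. For a rooted tree $T$, $t(v)$ denotes the parent of $v$; ancestors and descendants include the vertex itself. $T$ has the parent property if for every arc $(v,w)\in A$, $t(w)$ is an ancestor of $v$ in $T$. $T$ has the sibling property if for all siblings $v,w$ in $T$, $v$ does not dominate $w$. A preorder of $T$ is a total order of its vertices such that for every vertex $v$, the descendants of $v$ are ordered consecutively with $v$ first. A preorder of $T$ is low-high on $G$ if for every $v\neq s$, either $(t(v),v)\in A$, or there are two arcs $(u,v),(w,v)\in A$ with $u<v<w$ in the order and $w$ not a descendant of $v$ in $T$. -}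

module Defs where

open import Data.Nat using (ℕ; _<_; _≤_)
open import Data.Fin using (Fin)
open import Data.List using (List; []; _∷_)
open import Data.List.Membership.Propositional using (_∈_)
open import Data.Product using (_×_; _,_; Σ; ∃; ∃-syntax)
open import Data.Sum using (_⊎_)
open import Relation.Nullary using (¬_)
open import Relation.Binary.PropositionalEquality using (_≡_; _≢_)
open import Function.Bundles using (_⇔_)

Graph : ℕ → Set
Graph n = List (Fin n × Fin n)

module _ {n : ℕ} (A : Graph n) where

  Arc : Fin n → Fin n → Set
  Arc u v = (u , v) ∈ A

  data Walk (u : Fin n) : Fin n → Set where
    start : Walk u u
    step  : ∀ {v w} → Walk u v → Arc v w → Walk u w

  verts : ∀ {u w} → Walk u w → List (Fin n)
  verts {u} start = u ∷ []
  verts {w = w} (step p _) = w ∷ verts p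

  record IsFlowGraph (s : Fin n) : Set where
    field
      more-than-one : 1 < n
      no-entering   : ∀ v → ¬ Arc v s
      reachable     : ∀ v → Walk s v

  Dominates : Fin n → Fin n → Fin n → Set
  Dominates s v w = (p : Walk s w) → v ∈ verts p

-- Rooted tree whose vertex set is a subset of Fin n.
-- Parent function is only meaningful on non-root tree vertices.
module _ {n : ℕ} (root : Fin n) (parent : Fin n → Fin n) where

  data Ancestor (v : Fin n) : Fin n → Set where
    here : Ancestor v v
    up   : ∀ {w} → w ≢ root → Ancestor v (parent w) → Ancestor v w

record RootedTree (n : ℕ) : Set₁ where
  field
    InT     : Fin n → Set
    root    : Fin n
    parent  : Fin n → Fin n
    root∈   : InT root
    parent∈ : ∀ v → InT v → v ≢ root → InT (parent v)
    toRoot  : ∀ v → InT v → Ancestor root parent root v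

  Anc : Fin n → Fin n → Set
  Anc = Ancestor root parent

module _ {n : ℕ} (A : Graph n) (s : Fin n) (T : RootedTree n) where
  open RootedTree T

  ParentProperty : Set
  ParentProperty = ∀ v w → Arc A v w →
    InT v × InT w × w ≢ root × Anc (parent w) v

  Siblings : Fin n → Fin n → Set
  Siblings v w = v ≢ w × InT v × InT w × v ≢ root × w ≢ root × parent v ≡ parent w

  SiblingProperty : Set
  SiblingProperty = ∀ v w → Siblings v w → ¬ Dominates A s v w

  -- num represents a total order on the vertices of T (injective on T):
  -- x precedes y iff num x < num y.  It is a preorder of T if the
  -- descendants of every v are consecutive with v first.
  IsPreorder : (Fin n → ℕ) → Set
  IsPreorder num =
    (∀ x y → InT x → InT y → num x ≡ num y → x ≡ y) ×
    (∀ v w → InT v → InT w → Anc v w → num v ≤ num w) ×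
    (∀ v u w → InT v → InT u → InT w → Anc v w →
       num v ≤ num u → num u ≤ num w → Anc v u)

  LowHigh : (Fin n → ℕ) → Set
  LowHigh num = ∀ v → InT v → v ≢ s →
    Arc A (parent v) v ⊎
    (∃[ u ] ∃[ w ] (Arc A u v × Arc A w v × num u < num v × num v < num w × ¬ Anc v w))

  IsDominatorTree : Set
  IsDominatorTree = (∀ v → InT v) × root ≡ s × (∀ v w → Anc v w ⇔ Dominates A s v w)

module Submission where

-- The parent property makes every T-ancestor of w a dominator
-- of w: tracing an s-w walk backwards, each arc (x,y) leaves a T-descendant of
-- t(y).  Conversely, suppose v dominates some vertex that is not a descendant
-- of v ("stray").  Climbing the parent chain from it we reach a "boundary"
-- vertex y: stray, with t(y) not dominated by v.  No arc (t(y),y) exists, so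
-- low-high gives a low in-arc of the first boundary vertex y₀ and a high
-- in-arc of the last one y₁; extremality forces both tails below v, and then
-- num v < num y₀ ≤ num y₁ < num x with x below v puts y₀ below v by convexity
-- of the preorder.  Domination is decided only under a double negation, which
-- suffices since the goal is ⊥.  The sibling property follows from
-- "dominator ⇒ ancestor" and antisymmetry of the ancestor relation.

open import Defs
open import Data.Nat using (ℕ; zero; suc; _≤_; _<_)
open import Data.Nat.Properties
  using (≤-totalOrder; ≤-antisym; ≤-trans; <⇒≤; <-irrefl; ≤-<-trans)
open import Data.Fin using (Fin; _≟_) renaming (zero to fzero; suc to fsuc)
open import Data.List using (allFin; filter)
open import Data.List.Extrema ≤-totalOrder
  using (argmin; argmax; argmin-all; argmax-all; f[argmin]≤f[xs]; f[xs]≤f[argmax])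
open import Data.List.Membership.Propositional using (_∈_)
open import Data.List.Membership.Propositional.Properties using (∈-allFin; ∈-filter⁺)
open import Data.List.Relation.Unary.All using (lookup)
open import Data.List.Relation.Unary.All.Properties using (all-filter)
open import Data.List.Relation.Unary.Any using (here; there)
open import Data.Product using (_×_; _,_; Σ; ∃; ∃-syntax; proj₁; proj₂)
open import Data.Sum using (_⊎_; inj₁; inj₂)
open import Data.Empty using (⊥; ⊥-elim)
open import Relation.Nullary using (¬_; Dec; yes; no)
open import Relation.Nullary.Decidable using (¬¬-excluded-middle)
open import Relation.Binary.PropositionalEquality
  using (_≡_; _≢_; refl; sym; trans; cong; subst)
open import Function.Bundles using (mk⇔)

-- Every family of propositions over a finite type is decidable, up to double
-- negation.  Used to decide domination inside a proof by contradiction.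
¬¬-decidable-Fin : ∀ {n} (P : Fin n → Set) → ¬ ¬ (∀ y → Dec (P y))
¬¬-decidable-Fin {zero}  P k = k (λ ())
¬¬-decidable-Fin {suc n} P k =
  ¬¬-excluded-middle λ P0? →
    ¬¬-decidable-Fin (λ y → P (fsuc y)) λ Psuc? →
      k λ { fzero → P0? ; (fsuc y) → Psuc? y }

module Extremal {n : ℕ} (P : Fin n → Set) (P? : ∀ y → Dec (P y)) (f : Fin n → ℕ) where

  minimiser : ∃ P → ∃[ m ] P m × (∀ y → P y → f m ≤ f y)
  minimiser (a , Pa) =
    argmin f a members , argmin-all f Pa (all-filter P? (allFin n)) ,
    λ y Py → lookup (f[argmin]≤f[xs] a members) (∈-filter⁺ P? (∈-allFin y) Py)
    where members = filter P? (allFin n)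

  maximiser : ∃ P → ∃[ m ] P m × (∀ y → P y → f y ≤ f m)
  maximiser (a , Pa) =
    argmax f a members , argmax-all f Pa (all-filter P? (allFin n)) ,
    λ y Py → lookup (f[xs]≤f[argmax] a members) (∈-filter⁺ P? (∈-allFin y) Py)
    where members = filter P? (allFin n)

module WalkFacts {n : ℕ} (A : Graph n) where

  lastArc : ∀ {u w} → Walk A u w → u ≡ w ⊎ ∃[ v ] Arc A v w
  lastArc start             = inj₁ refl
  lastArc (step {v = v} _ a) = inj₂ (v , a)

  prefixTo : ∀ {s w} (p : Walk A s w) {b} → b ∈ verts A p →
    Σ (Walk A s b) λ q → ∀ {c} → c ∈ verts A q → c ∈ verts A p
  prefixTo start        (here refl) = start , λ c∈ → c∈
  prefixTo (step p a)   (here refl) = step p a , λ c∈ → c∈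
  prefixTo (step p _)   (there b∈) with prefixTo p b∈
  ... | q , q⊆p = q , λ c∈ → there (q⊆p c∈)

  dominates-trans : ∀ {s a b c} → Dominates A s a b → Dominates A s b c → Dominates A s a c
  dominates-trans a-dom-b b-dom-c p with prefixTo p (b-dom-c p)
  ... | q , q⊆p = q⊆p (a-dom-b q)

  dominates-pred : ∀ {s v y z} → Dominates A s v y → Arc A z y → y ≢ v → Dominates A s v z
  dominates-pred v-dom-y a y≢v p with v-dom-y (step p a)
  ... | here v≡y  = ⊥-elim (y≢v (sym v≡y))
  ... | there v∈p = v∈p

  dominates-start : ∀ {s v} → Dominates A s v s → v ≡ s
  dominates-start v-dom-s with v-dom-s start
  ... | here v≡s = v≡s
  ... | there ()

module TreeFacts {n : ℕ} (T : RootedTree n) where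
  open RootedTree T

  anc-trans : ∀ {a b c} → Anc a b → Anc b c → Anc a c
  anc-trans a-b here         = a-b
  anc-trans a-b (up c≢r b-c) = up c≢r (anc-trans a-b b-c)

  anc? : ∀ v {w} → Anc root w → Dec (Anc v w)
  anc? v here with v ≟ root
  ... | yes refl = yes here
  ... | no v≢r   = no λ { here → v≢r refl ; (up r≢r _) → r≢r refl }
  anc? v {w} (up w≢r r-pw) with v ≟ w
  ... | yes refl = yes here
  ... | no v≢w with anc? v r-pw
  ...   | yes v-pw = yes (up w≢r v-pw)
  ...   | no ¬v-pw = no λ { here → v≢w refl ; (up _ v-pw) → ¬v-pw v-pw }

  -- A vertex fixed by the parent function is its own only ancestor (stated
  -- for any y ≡ x so that the recursion on the chain stays structural).
  fixed-only-ancestor : ∀ {r y x} → Anc r y → y ≡ x → parent x ≡ x → r ≡ x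
  fixed-only-ancestor here         y≡x _     = y≡x
  fixed-only-ancestor (up _ r-py) y≡x fixed =
    fixed-only-ancestor r-py (trans (cong parent y≡x) fixed) fixed

  topOfSegment : (Q : Fin n → Set) → (∀ y → Dec (Q y)) → ¬ Q root →
    ∀ {z} → Anc root z → Q z → ∃[ y ] Q y × ¬ Q (parent y) × Anc y z
  topOfSegment Q Q? ¬Qr here Qz = ⊥-elim (¬Qr Qz)
  topOfSegment Q Q? ¬Qr {z} (up z≢r r-pz) Qz with Q? (parent z)
  ... | no ¬Qpz = z , Qz , ¬Qpz , here
  ... | yes Qpz with topOfSegment Q Q? ¬Qr r-pz Qpz
  ...   | y , Qy , ¬Qpy , y-pz = y , Qy , ¬Qpy , anc-trans y-pz (up z≢r here)

module LowHighTree {n : ℕ} (A : Graph n) (s : Fin n) (flow : IsFlowGraph A s)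
  (T : RootedTree n) (parentProp : ParentProperty A s T) (num : Fin n → ℕ)
  (num-injective : ∀ x y → RootedTree.InT T x → RootedTree.InT T y → num x ≡ num y → x ≡ y)
  (num-monotone : ∀ v w → RootedTree.InT T v → RootedTree.InT T w →
     RootedTree.Anc T v w → num v ≤ num w)
  (num-convex : ∀ v u w → RootedTree.InT T v → RootedTree.InT T u → RootedTree.InT T w →
     RootedTree.Anc T v w → num v ≤ num u → num u ≤ num w → RootedTree.Anc T v u)
  (lowHigh : LowHigh A s T num) where
  open RootedTree T
  open IsFlowGraph flow
  open WalkFacts A
  open TreeFacts T

  Dom : Fin n → Fin n → Set
  Dom = Dominates A s

  head∈T : ∀ {u w} → Arc A u w → InT w
  head∈T {u} {w} a = proj₁ (proj₂ (parentProp u w a))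

  head≢root : ∀ {u w} → Arc A u w → w ≢ root
  head≢root {u} {w} a = proj₁ (proj₂ (proj₂ (parentProp u w a)))

  parent-above-tail : ∀ {u w} → Arc A u w → Anc (parent w) u
  parent-above-tail {u} {w} a = proj₂ (proj₂ (proj₂ (parentProp u w a)))

  -- No arc enters the root, so the root is s.
  root≡s : root ≡ s
  root≡s with lastArc (reachable root)
  ... | inj₁ s≡r      = sym s≡r
  ... | inj₂ (_ , a) = ⊥-elim (head≢root a refl)

  -- Every vertex has an in-arc or is s, so every vertex lies in T.
  inT : ∀ v → InT v
  inT v with lastArc (reachable v)
  ... | inj₁ s≡v      = subst InT (trans root≡s s≡v) root∈
  ... | inj₂ (_ , a) = head∈T a

  root-above : ∀ v → Anc root v
  root-above v = toRoot v (inT v)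

  anc-antisym : ∀ {a b} → Anc a b → Anc b a → a ≡ b
  anc-antisym {a} {b} a-b b-a = num-injective a b (inT a) (inT b)
    (≤-antisym (num-monotone a b (inT a) (inT b) a-b) (num-monotone b a (inT b) (inT a) b-a))

  ancestor-on-walk : ∀ {w} (p : Walk A s w) {a} → Anc a w → a ∈ verts A p
  ancestor-on-walk start        here         = here refl
  ancestor-on-walk start        (up s≢r _)  = ⊥-elim (s≢r (sym root≡s))
  ancestor-on-walk (step p _)   here         = here refl
  ancestor-on-walk (step p a)   (up _ x-pw) =
    there (ancestor-on-walk p (anc-trans x-pw (parent-above-tail a)))

  ancestor⇒dominates : ∀ {a w} → Anc a w → Dom a w
  ancestor⇒dominates a-w p = ancestor-on-walk p a-w

  module NoStray (v : Fin n) (v≢s : v ≢ s) (Dom? : ∀ y → Dec (Dom v y)) where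

    Stray : Fin n → Set
    Stray y = Dom v y × ¬ Anc v y

    Boundary : Fin n → Set
    Boundary y = Stray y × ¬ Dom v (parent y)

    Boundary? : ∀ y → Dec (Boundary y)
    Boundary? y with Dom? y | anc? v (root-above y) | Dom? (parent y)
    ... | no ¬d  | _       | _       = no λ b → ¬d (proj₁ (proj₁ b))
    ... | yes _  | yes v-y | _       = no λ b → proj₂ (proj₁ b) v-y
    ... | yes _  | no _    | yes dp  = no λ b → proj₂ b dp
    ... | yes d  | no ¬v-y | no ¬dp  = yes ((d , ¬v-y) , ¬dp)

    stray≢v : ∀ {y} → Stray y → y ≢ v
    stray≢v (_ , ¬v-y) refl = ¬v-y here

    boundary≢s : ∀ {y} → Boundary y → y ≢ s
    boundary≢s ((d , _) , _) refl = v≢s (dominates-start d)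

    dominated-tail : ∀ {y z} → Stray y → Arc A z y → Dom v z
    dominated-tail st a = dominates-pred (proj₁ st) a (stray≢v st)

    root-undominated : ¬ Dom v root
    root-undominated d = v≢s (dominates-start (subst (Dom v) root≡s d))

    boundaryAbove : ∀ {z} → Stray z → ∃[ y ] Boundary y × Anc y z
    boundaryAbove {z} (d , ¬v-z) with topOfSegment (Dom v) Dom? root-undominated (root-above z) d
    ... | y , dy , ¬dpy , y-z = y , ((dy , λ v-y → ¬v-z (anc-trans v-y y-z)) , ¬dpy) , y-z

    lowHighArcs : ∀ {y} → Boundary y →
      ∃[ u ] ∃[ x ] (Arc A u y × Arc A x y × num u < num y × num y < num x × ¬ Anc y x)
    lowHighArcs {y} b with lowHigh y (inT y) (boundary≢s b)
    ... | inj₁ a    = ⊥-elim (proj₂ b (dominated-tail (proj₁ b) a))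
    ... | inj₂ arcs = arcs

    lowTail : ∀ y₀ → Boundary y₀ → (∀ y → Boundary y → num y₀ ≤ num y) →
      ∃[ u ] Anc v u × num u < num y₀
    lowTail y₀ b₀ first with lowHighArcs b₀
    ... | u , _ , au , _ , u<y₀ , _ with anc? v (root-above u)
    ...   | yes v-u = u , v-u , u<y₀
    ...   | no ¬v-u with boundaryAbove (dominated-tail (proj₁ b₀) au , ¬v-u)
    ...     | y , b , y-u = ⊥-elim (<-irrefl refl
              (≤-<-trans (≤-trans (first y b) (num-monotone y u (inT y) (inT u) y-u)) u<y₀))

    highTail : ∀ y₁ → Boundary y₁ → (∀ y → Boundary y → num y ≤ num y₁) →
      ∃[ x ] Anc v x × num y₁ < num x
    highTail y₁ b₁ last with lowHighArcs b₁
    ... | _ , x , _ , ax , _ , y₁<x , ¬y₁-x with anc? v (root-above x)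
    ...   | yes v-x = x , v-x , y₁<x
    ...   | no ¬v-x with boundaryAbove (dominated-tail (proj₁ b₁) ax , ¬v-x)
    ...     | y , b , y-x
      with num-convex y y₁ x (inT y) (inT y₁) (inT x) y-x (last y b) (<⇒≤ y₁<x)
    ...       | here         = ⊥-elim (¬y₁-x y-x)
    ...       | up _ y-py₁  =
      ⊥-elim (proj₂ b₁ (dominates-trans (proj₁ (proj₁ b)) (ancestor⇒dominates y-py₁)))

    noStray : ∀ w → ¬ Stray w
    noStray w st with boundaryAbove st
    ... | b , isB , _ with Extremal.minimiser Boundary Boundary? num (b , isB)
                         | Extremal.maximiser Boundary Boundary? num (b , isB)
    ... | y₀ , b₀ , first | y₁ , b₁ , last
      with lowTail y₀ b₀ first | highTail y₁ b₁ last
    ... | u , v-u , u<y₀ | x , v-x , y₁<x =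
      proj₂ (proj₁ b₀) (num-convex v y₀ x (inT v) (inT y₀) (inT x) v-x
        (≤-trans (num-monotone v u (inT v) (inT u) v-u) (<⇒≤ u<y₀))
        (≤-trans (first y₁ b₁) (<⇒≤ y₁<x)))

  dominates⇒ancestor : ∀ v w → Dom v w → Anc v w
  dominates⇒ancestor v w v-dom-w with anc? v (root-above w)
  ... | yes v-w = v-w
  ... | no ¬v-w = ⊥-elim (¬¬-decidable-Fin (Dom v)
          λ Dom? → NoStray.noStray v v≢s Dom? w (v-dom-w , ¬v-w))
    where
    v≢s : v ≢ s
    v≢s refl = ¬v-w (subst (λ r → Anc r w) root≡s (root-above w))

  -- A dominator of a sibling would be its own parent, hence the root.
  siblingProperty : SiblingProperty A s T
  siblingProperty v w (v≢w , _ , _ , v≢r , _ , pv≡pw) v-dom-w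
    with dominates⇒ancestor v w v-dom-w
  ... | here        = v≢w refl
  ... | up _ v-pw  = v≢r (sym (fixed-only-ancestor (root-above v) refl (sym v≡pv)))
    where
    v≡pv : v ≡ parent v
    v≡pv = anc-antisym (subst (Anc v) (sym pv≡pw) v-pw) (up v≢r here)

theorem9 : ∀ {n : ℕ} (A : Graph n) (s : Fin n) → IsFlowGraph A s →
    (T : RootedTree n) → ParentProperty A s T →
    (∃[ num ] (IsPreorder A s T num × LowHigh A s T num)) →
    SiblingProperty A s T × IsDominatorTree A s T
theorem9 A s flow T parentProp (num , (injective , monotone , convex) , lowHigh) =
  siblingProperty , inT , root≡s ,
  λ v w → mk⇔ ancestor⇒dominates (dominates⇒ancestor v w)
  where open LowHighTree A s flow T parentProp num injective monotone convex lowHigh
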